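{- Let $\ell_i=(\mathrm{get}^{\ell_i},\mathrm{put}^{\ell_i})$, $i=1,2$, be ala-lenses from $\mathbf{A}_i$ to $\mathbf{B}_i$ with parameter categories $\mathbf{P}_i$, and let $\ell_1\|\ell_2$ be their parallel composition, an ala-lens from $\mathbf{A}_1\times\mathbf{A}_2$ to $\mathbf{B}_1\times\mathbf{B}_2$ with parameter category $\mathbf{P}_1\times\mathbf{P}_2$. If $\ell_1$ and $\ell_2$ are both well-behaved, then $\ell_1\|\ell_2$ is well-behaved.
   Context: Notation: for a category $\mathbf{X}$, $|\mathbf{X}|$ is its class of objects; composition of arrows is written in diagrammatic order $u;u'$. Parameterized functor: given categories $\mathbf{S},\mathbf{T},\mathbf{P}$, a functor $\mathrm{get}:\mathbf{P}\to[\mathbf{S},\mathbf{T}]$. For $p\in|\mathbf{P}|$ write $\mathrm{get}_p=\mathrm{get}(p)$, $S_p=\mathrm{get}_p(S)$; for $e:p\to p'$, $\mathrm{get}_e:\mathrm{get}_p\Rightarrow\mathrm{get}_{p'}$ with components $e_S$, and for $u:S\to S'$, $u.\mathrm{get}_e:=e_S;\mathrm{get}_{p'}(u):S_p\to S'_{p'}$. Ala-lens from $\mathbf{S}$ to $\mathbf{T}$ with parameter category $\mathbf{P}$: a pair $(\mathrm{get},\mathrm{put})$ with $\mathrm{get}:\mathbf{P}\to[\mathbf{S},\mathbf{T}]$ and three families indexed by $(p,S)\in|\mathbf{P}|\times|\mathbf{S}|$ assigning to every $v:S_p\to T'$ in $\mathbf{T}$ arrows $\mathrm{put}^{\mathrm{upd}}_{p,S}(v):p\to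 p'$, $\mathrm{put}^{\mathrm{req}}_{p,S}(v):S\to S'$, and $\mathrm{put}^{\mathrm{self}}_{p,S}(v)=:v^@:T'\to\mathrm{get}_{p'}(S')$. Well-behaved: for all $p,S$ and $v:S_p\to T'$: (Stability) the three puts send $\mathrm{id}_{S_p}$ to $\mathrm{id}_p$, $\mathrm{id}_S$, $\mathrm{id}_{S_p}$ respectively; (Putget) $(\mathrm{put}^{\mathrm{req}}_{p,S}(v)).\mathrm{get}_e=v;v^@$ where $e=\mathrm{put}^{\mathrm{upd}}_{p,S}(v)$. Parallel composition $\ell_1\|\ell_2$: parameter category $\mathbf{P}_1\times\mathbf{P}_2$; $\mathrm{get}_{(p_1,p_2)}=\mathrm{get}^{\ell_1}_{p_1}\times\mathrm{get}^{\ell_2}_{p_2}$ (and componentwise on parameter arrows); for $(S_1,S_2)$ and $(v_1,v_2):(\mathrm{get}^{\ell_1}_{p_1}(S_1),\mathrm{get}^{\ell_2}_{p_2}(S_2))\to(B'_1,B'_2)$, each put operation $x\in\{\mathrm{upd},\mathrm{req},\mathrm{self}\}$ is defined componentwise: $\mathrm{put}^{x}_{(p_1,p_2),(S_1,S_2)}(v_1,v_2)=(\mathrm{put}^{\ell_1,x}_{p_1,S_1}(v_1),\mathrm{put}^{\ell_2,x}_{p_2,S_2}(v_2))$. -}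

module Defs where

open import Level using (Level; _⊔_; suc)
open import Data.Product using (Σ; Σ-syntax; _×_; _,_; proj₁; proj₂)
open import Relation.Binary.PropositionalEquality using (_≡_; refl; cong₂)

-- Categories with propositional equality of arrows; composition is
-- written in diagrammatic order  f ⨾ g  (first f, then g).
record Category (o h : Level) : Set (suc (o ⊔ h)) where
  infixr 9 _⨾_
  field
    Obj  : Set o
    Hom  : Obj → Obj → Set h
    id   : ∀ {A} → Hom A A
    _⨾_  : ∀ {A B C} → Hom A B → Hom B C → Hom A C
    idˡ  : ∀ {A B} (f : Hom A B) → id ⨾ f ≡ f
    idʳ  : ∀ {A B} (f : Hom A B) → f ⨾ id ≡ f
    assoc : ∀ {A B C D} (f : Hom A B) (g : Hom B C) (k : Hom C D) →
            (f ⨾ g) ⨾ k ≡ f ⨾ (g ⨾ k)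

open Category

private variable
  o₁ h₁ o₂ h₂ o₃ h₃ o₄ h₄ o₅ h₅ o₆ h₆ : Level

_⊗_ : Category o₁ h₁ → Category o₂ h₂ → Category (o₁ ⊔ o₂) (h₁ ⊔ h₂)
C ⊗ D = record
  { Obj = Obj C × Obj D
  ; Hom = λ { (a , b) (a' , b') → Hom C a a' × Hom D b b' }
  ; id = id C , id D
  ; _⨾_ = λ { (f , g) (f' , g') → _⨾_ C f f' , _⨾_ D g g' }
  ; idˡ = λ { (f , g) → cong₂ _,_ (idˡ C f) (idˡ D g) }
  ; idʳ = λ { (f , g) → cong₂ _,_ (idʳ C f) (idʳ D g) }
  ; assoc = λ { (f , g) (f' , g') (f'' , g'') →
                cong₂ _,_ (assoc C f f' f'') (assoc D g g' g'') }
  }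

record Functor (S : Category o₁ h₁) (T : Category o₂ h₂)
       : Set (o₁ ⊔ h₁ ⊔ o₂ ⊔ h₂) where
  field
    F₀ : Obj S → Obj T
    F₁ : ∀ {A B} → Hom S A B → Hom T (F₀ A) (F₀ B)
    F-id : ∀ {A} → F₁ (id S {A}) ≡ id T
    F-comp : ∀ {A B C} (f : Hom S A B) (g : Hom S B C) →
             F₁ (_⨾_ S f g) ≡ _⨾_ T (F₁ f) (F₁ g)

-- A parameterized functor  get : P → [S , T],  written out: each
-- parameter p gives a functor get_p, each parameter arrow e : p → p'
-- gives a natural transformation get_e : get_p ⇒ get_p' (components e_S),
-- and the assignment is functorial (equality of natural transformations
-- is componentwise equality).
record ParamFunctor (P : Category o₁ h₁) (S : Category o₂ h₂)
                    (T : Category o₃ h₃)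
       : Set (o₁ ⊔ h₁ ⊔ o₂ ⊔ h₂ ⊔ o₃ ⊔ h₃) where
  field
    get : Obj P → Functor S T
  get₀ : Obj P → Obj S → Obj T
  get₀ p A = Functor.F₀ (get p) A
  get₁ : (p : Obj P) → ∀ {A B} → Hom S A B → Hom T (get₀ p A) (get₀ p B)
  get₁ p u = Functor.F₁ (get p) u
  field
    comp : ∀ {p p'} → Hom P p p' → (A : Obj S) → Hom T (get₀ p A) (get₀ p' A)
    natural : ∀ {p p'} (e : Hom P p p') {A B} (u : Hom S A B) →
              _⨾_ T (comp e A) (get₁ p' u) ≡ _⨾_ T (get₁ p u) (comp e B)
    comp-id : ∀ {p} (A : Obj S) → comp (id P {p}) A ≡ id T
    comp-⨾ : ∀ {p p' p''} (e : Hom P p p') (e' : Hom P p' p'') (A : Obj S) →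
             comp (_⨾_ P e e') A ≡ _⨾_ T (comp e A) (comp e' A)

  _∙get_ : ∀ {p p'} {A B} → Hom S A B → Hom P p p' → Hom T (get₀ p A) (get₀ p' B)
  u ∙get e = _⨾_ T (comp e _) (get₁ _ u)

record AlaLens (P : Category o₁ h₁) (S : Category o₂ h₂)
               (T : Category o₃ h₃)
       : Set (o₁ ⊔ h₁ ⊔ o₂ ⊔ h₂ ⊔ o₃ ⊔ h₃) where
  field
    getF : ParamFunctor P S T
  open ParamFunctor getF public
  field
    putUpd : (p : Obj P) (A : Obj S) {T' : Obj T} →
             Hom T (get₀ p A) T' → Σ[ p' ∈ Obj P ] Hom P p p'
    putReq : (p : Obj P) (A : Obj S) {T' : Obj T} →
             Hom T (get₀ p A) T' → Σ[ A' ∈ Obj S ] Hom S A A'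
    putSelf : (p : Obj P) (A : Obj S) {T' : Obj T} →
              (v : Hom T (get₀ p A) T') →
              Hom T T' (get₀ (proj₁ (putUpd p A v)) (proj₁ (putReq p A v)))

module _ {P : Category o₁ h₁} {S : Category o₂ h₂} {T : Category o₃ h₃}
         (ℓ : AlaLens P S T) where
  open AlaLens ℓ

  -- the triple (p', S', v^@) packaged so that stability of put^self
  -- can be stated as an equality (its type depends on p', S')
  selfPack : (p : Obj P) (A : Obj S) {T' : Obj T} → Hom T (get₀ p A) T' →
             Σ[ q ∈ Obj P × Obj S ] Hom T T' (get₀ (proj₁ q) (proj₂ q))
  selfPack p A v = (proj₁ (putUpd p A v) , proj₁ (putReq p A v)) , putSelf p A v

  record WellBehaved : Set (o₁ ⊔ h₁ ⊔ o₂ ⊔ h₂ ⊔ o₃ ⊔ h₃) where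
    field
      stab-upd  : (p : Obj P) (A : Obj S) → putUpd p A (id T) ≡ (p , id P)
      stab-req  : (p : Obj P) (A : Obj S) → putReq p A (id T) ≡ (A , id S)
      stab-self : (p : Obj P) (A : Obj S) →
                  selfPack p A (id T) ≡ ((p , A) , id T)
      putget : (p : Obj P) (A : Obj S) {T' : Obj T}
               (v : Hom T (get₀ p A) T') →
               proj₂ (putReq p A v) ∙get proj₂ (putUpd p A v)
                 ≡ _⨾_ T v (putSelf p A v)

_∥_ : {P₁ : Category o₁ h₁} {A₁ : Category o₂ h₂} {B₁ : Category o₃ h₃}
      {P₂ : Category o₄ h₄} {A₂ : Category o₅ h₅} {B₂ : Category o₆ h₆} →
      AlaLens P₁ A₁ B₁ → AlaLens P₂ A₂ B₂ →
      AlaLens (P₁ ⊗ P₂) (A₁ ⊗ A₂) (B₁ ⊗ B₂)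
_∥_ {P₁ = P₁} {A₁} {B₁} {P₂} {A₂} {B₂} ℓ₁ ℓ₂ = record
  { getF = record
    { get = λ { (p₁ , p₂) → record
        { F₀ = λ { (a₁ , a₂) → L₁.get₀ p₁ a₁ , L₂.get₀ p₂ a₂ }
        ; F₁ = λ { (u₁ , u₂) → L₁.get₁ p₁ u₁ , L₂.get₁ p₂ u₂ }
        ; F-id = cong₂ _,_ (Functor.F-id (L₁.get p₁)) (Functor.F-id (L₂.get p₂))
        ; F-comp = λ { (f₁ , f₂) (g₁ , g₂) →
            cong₂ _,_ (Functor.F-comp (L₁.get p₁) f₁ g₁)
                      (Functor.F-comp (L₂.get p₂) f₂ g₂) }
        } }
    ; comp = λ { (e₁ , e₂) (a₁ , a₂) → L₁.comp e₁ a₁ , L₂.comp e₂ a₂ }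
    ; natural = λ { (e₁ , e₂) (u₁ , u₂) →
        cong₂ _,_ (L₁.natural e₁ u₁) (L₂.natural e₂ u₂) }
    ; comp-id = λ { (a₁ , a₂) → cong₂ _,_ (L₁.comp-id a₁) (L₂.comp-id a₂) }
    ; comp-⨾ = λ { (e₁ , e₂) (e₁' , e₂') (a₁ , a₂) →
        cong₂ _,_ (L₁.comp-⨾ e₁ e₁' a₁) (L₂.comp-⨾ e₂ e₂' a₂) }
    }
  ; putUpd = λ { (p₁ , p₂) (a₁ , a₂) (v₁ , v₂) →
      let (q₁ , e₁) = L₁.putUpd p₁ a₁ v₁ ; (q₂ , e₂) = L₂.putUpd p₂ a₂ v₂
      in (q₁ , q₂) , (e₁ , e₂) }
  ; putReq = λ { (p₁ , p₂) (a₁ , a₂) (v₁ , v₂) →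
      let (b₁ , u₁) = L₁.putReq p₁ a₁ v₁ ; (b₂ , u₂) = L₂.putReq p₂ a₂ v₂
      in (b₁ , b₂) , (u₁ , u₂) }
  ; putSelf = λ { (p₁ , p₂) (a₁ , a₂) (v₁ , v₂) →
      L₁.putSelf p₁ a₁ v₁ , L₂.putSelf p₂ a₂ v₂ }
  }
  where
    module L₁ = AlaLens ℓ₁
    module L₂ = AlaLens ℓ₂

module Submission where

open import Level using (Level)
open import Defs
open import Data.Product using (_,_; zip; zip′)
open import Relation.Binary.PropositionalEquality using (cong₂)

theorem2 : ∀ {o₁ h₁ o₂ h₂ o₃ h₃ o₄ h₄ o₅ h₅ o₆ h₆ : Level}
             {P₁ : Category o₁ h₁} {A₁ : Category o₂ h₂} {B₁ : Category o₃ h₃}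
             {P₂ : Category o₄ h₄} {A₂ : Category o₅ h₅} {B₂ : Category o₆ h₆}
             (ℓ₁ : AlaLens P₁ A₁ B₁) (ℓ₂ : AlaLens P₂ A₂ B₂) →
             WellBehaved ℓ₁ → WellBehaved ℓ₂ → WellBehaved (ℓ₁ ∥ ℓ₂)
theorem2 ℓ₁ ℓ₂ w₁ w₂ = record
  { stab-upd  = λ (p₁ , p₂) (a₁ , a₂) →
      cong₂ (zip _,_ _,_) (W₁.stab-upd p₁ a₁) (W₂.stab-upd p₂ a₂)
  ; stab-req  = λ (p₁ , p₂) (a₁ , a₂) →
      cong₂ (zip _,_ _,_) (W₁.stab-req p₁ a₁) (W₂.stab-req p₂ a₂)
  -- selfPack of ℓ₁ ∥ ℓ₂ indexes by ((p₁' , p₂') , (a₁' , a₂')), so the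
  -- components' indices (pᵢ' , aᵢ') must be transposed when zipped.
  ; stab-self = λ (p₁ , p₂) (a₁ , a₂) →
      cong₂ (zip (zip′ _,_ _,_) _,_) (W₁.stab-self p₁ a₁) (W₂.stab-self p₂ a₂)
  ; putget    = λ (p₁ , p₂) (a₁ , a₂) (v₁ , v₂) →
      cong₂ _,_ (W₁.putget p₁ a₁ v₁) (W₂.putget p₂ a₂ v₂)
  }
  where
    module W₁ = WellBehaved w₁
    module W₂ = WellBehaved w₂
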